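{- Let $G=(V,E)$ be a $d$-regular graph with $d\geq 14$, $d\neq 15$, $d\neq 17$, and let $r\in\{0,1\}$ be such that $d\equiv r \pmod 2$. Then $V$ can be partitioned into sets $V_0$ and $V_1$ such that: (i) $d_{V_0}(v)\geq 2+r$ for every $v\in V_0$; (ii) $d_{V_1}(v)\geq 2$ for every $v\in V_0$; (iii) $d_{V_1}(v)\geq 2+r$ for every $v\in V_1$; (iv) $d_{V_0}(v)\geq 2$ for every $v\in V_1$.
   Context: All graphs are finite and simple. For a vertex $v$ and a set $S\subseteq V$, $d_S(v)$ denotes the number of edges $uv\in E$ with $u\in S$. -}

module Defs where

open import Data.Nat using (ℕ; zero; suc; _+_)
open import Data.Bool using (Bool; true; false; _∧_; not)
open import Data.Fin using (Fin)
open import Data.List using (List; filter; length)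
open import Data.List.Base using (allFin)
open import Relation.Binary.PropositionalEquality using (_≡_)
open import Relation.Nullary using (¬_)
open import Data.Bool using (T?)

record Graph (n : ℕ) : Set where
  field
    adj   : Fin n → Fin n → Bool
    sym   : ∀ u v → adj u v ≡ adj v u
    irrefl : ∀ v → adj v v ≡ false

open Graph public

VSet : ℕ → Set
VSet n = Fin n → Bool

degIn : ∀ {n} → Graph n → VSet n → Fin n → ℕ
degIn {n} G S v = length (filter (λ u → T? (adj G u v ∧ S u)) (allFin n))

deg : ∀ {n} → Graph n → Fin n → ℕ
deg G v = degIn G (λ _ → true) v

Regular : ∀ {n} → Graph n → ℕ → Set
Regular {n} G d = ∀ v → deg G v ≡ d

compl : ∀ {n} → VSet n → VSet n
compl S v = not (S v)

module Submission where

-- A 2-colouring of the vertices of a d-regular graph (d ≥ 14, d ∉ {15,17})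
-- in which every vertex has at least k neighbours of each colour, where k = 2
-- for d ∈ {14,16,18} and k = 3 for d ≥ 19; taking V₀ to be one colour class
-- gives the four degree conditions of the theorem.
--
-- The colouring is found with the Lovász Local Lemma, proved here in a purely
-- counting form: probabilities are numbers of colourings of n coordinates,
-- scaled by 2ⁿ.

open import Defs hiding (sym)
open import Data.Nat using (ℕ; zero; suc; _+_; _*_; _^_; _≤_; _<_; _<ᵇ_; _%_; z≤n; s≤s; NonZero; >-nonZero; >-nonZero⁻¹)
open import Data.Nat.Properties hiding (_≟_)
open import Data.Nat.DivMod using (m%n<n)
open import Data.Nat.Tactic.RingSolver using (solve-∀)
open import Data.Bool using (Bool; true; false; _∧_; _∨_; not; T; T?)
open import Data.Bool.Properties using (∧-comm; ∧-conicalˡ; ∧-conicalʳ; ∧-identityʳ; ∧-zeroʳ; ∨-identityʳ; ∨-zeroʳ; ∨-conicalˡ; ∨-conicalʳ; not-involutive)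
open import Data.Fin using (Fin; zero; suc; _≟_)
open import Data.List using (filter; length; tabulate)
open import Data.Product using (Σ; ∃; _×_; _,_; proj₁; proj₂)
open import Data.Empty using (⊥-elim)
open import Data.Unit using (tt)
open import Function using (_∘_; id)
open import Relation.Nullary using (does; yes; no)
open import Relation.Nullary.Decidable using (True; dec-true; toWitness)
open import Relation.Binary.PropositionalEquality using (_≡_; _≢_; refl; sym; trans; cong; cong₂; subst; subst₂; module ≡-Reasoning)

+-interchange : ∀ w x y z → w + x + (y + z) ≡ w + y + (x + z)
+-interchange = interchange
  where open import Algebra.Properties.CommutativeSemigroup +-commutativeSemigroup using (interchange)

∧-intro : ∀ {x y} → x ≡ true → y ≡ true → x ∧ y ≡ true
∧-intro refl refl = refl

not-true : ∀ {x} → not x ≡ true → x ≡ false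
not-true {false} _ = refl

true≢false : true ≢ false
true≢false ()

bool-ext : ∀ {x y} → (x ≡ true → y ≡ true) → (y ≡ true → x ≡ true) → x ≡ y
bool-ext {true}  {true}  _ _ = refl
bool-ext {true}  {false} f _ = sym (f refl)
bool-ext {false} {true}  _ g = g refl
bool-ext {false} {false} _ _ = refl

Subset : ℕ → Set
Subset n = Fin n → Bool

_⊆_ : ∀ {n} → Subset n → Subset n → Set
P ⊆ Q = ∀ i → P i ≡ true → Q i ≡ true

_⊂_ : ∀ {n} → Subset n → Subset n → Set
T ⊂ S = T ⊆ S × ∃ λ j → T j ≡ false × S j ≡ true

_∪_ _∩_ _∖_ : ∀ {n} → Subset n → Subset n → Subset n
(P ∪ Q) i = P i ∨ Q i
(P ∩ Q) i = P i ∧ Q i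
(P ∖ Q) i = P i ∧ not (Q i)

infix  4 _⊆_ _⊂_
infixl 6 _∪_
infixl 7 _∩_ _∖_

⁅_⁆ : ∀ {n} → Fin n → Subset n
⁅ j ⁆ i = does (i ≟ j)

∖-⊆ : ∀ {n} {P Q : Subset n} → P ∖ Q ⊆ P
∖-⊆ {P = P} i = ∧-conicalˡ (P i) _

∪-monoʳ-⊆ : ∀ {n} (S : Subset n) {Q Q' : Subset n} → Q ⊆ Q' → S ∪ Q ⊆ S ∪ Q'
∪-monoʳ-⊆ S Q⊆Q' i with S i
... | true  = λ _ → refl
... | false = Q⊆Q' i

split-by : ∀ {n} (S Q : Subset n) i → S i ≡ (S ∖ Q ∪ S ∩ Q) i
split-by S Q i with S i | Q i
... | true  | true  = refl
... | true  | false = refl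
... | false | _     = refl

reinsert : ∀ {n} (S U : Subset n) j → U j ≡ true → ∀ i → (S ∪ U) i ≡ (S ∪ U ∖ ⁅ j ⁆ ∪ ⁅ j ⁆) i
reinsert S U j Uj i with i ≟ j
... | yes refl rewrite Uj = trans (∨-zeroʳ (S j)) (sym (∨-zeroʳ _))
... | no _     = sym (trans (∨-identityʳ _) (cong (S i ∨_) (∧-identityʳ (U i))))

indicator : Bool → ℕ
indicator true  = 1
indicator false = 0

indicator-mono : ∀ {x y} → (x ≡ true → y ≡ true) → indicator x ≤ indicator y
indicator-mono {false} _ = z≤n
indicator-mono {true}  h rewrite h refl = ≤-refl

indicator-∨ : ∀ x y → indicator (x ∨ y) ≤ indicator x + indicator y
indicator-∨ true  _ = s≤s z≤n
indicator-∨ false _ = ≤-refl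

countFin : ∀ {n} → Subset n → ℕ
countFin {zero}  P = 0
countFin {suc n} P = indicator (P zero) + countFin (P ∘ suc)

sumFin : ∀ {n} → (Fin n → ℕ) → ℕ
sumFin {zero}  f = 0
sumFin {suc n} f = f zero + sumFin (f ∘ suc)

every some : ∀ {n} → Subset n → Bool
every {zero}  P = true
every {suc n} P = P zero ∧ every (P ∘ suc)
some  {zero}  P = false
some  {suc n} P = P zero ∨ some (P ∘ suc)

every-elim : ∀ {n} (P : Subset n) → every P ≡ true → ∀ i → P i ≡ true
every-elim P h zero    = ∧-conicalˡ _ _ h
every-elim P h (suc i) = every-elim (P ∘ suc) (∧-conicalʳ (P zero) _ h) i

every-intro : ∀ {n} (P : Subset n) → (∀ i → P i ≡ true) → every P ≡ true
every-intro {zero}  P h = refl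
every-intro {suc n} P h rewrite h zero = every-intro (P ∘ suc) (h ∘ suc)

every-cong : ∀ {n} {P Q : Subset n} → (∀ i → P i ≡ Q i) → every P ≡ every Q
every-cong {zero}  e = refl
every-cong {suc n} e = cong₂ _∧_ (e zero) (every-cong (e ∘ suc))

some-false : ∀ {n} (P : Subset n) → some P ≡ false → ∀ i → P i ≡ false
some-false P h zero    with P zero
... | false = refl
some-false P h (suc i) with P zero
... | false = some-false (P ∘ suc) h i

length-filter-tabulate : ∀ {a} {A : Set a} {n} (g : Fin n → A) (Q : A → Bool) →
  length (filter (λ u → T? (Q u)) (tabulate g)) ≡ countFin (Q ∘ g)
length-filter-tabulate {n = zero}  g Q = refl
length-filter-tabulate {n = suc n} g Q with Q (g zero)
... | true  = cong suc (length-filter-tabulate (g ∘ suc) Q)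
... | false = length-filter-tabulate (g ∘ suc) Q

countFin-cong : ∀ {n} {P Q : Subset n} → (∀ i → P i ≡ Q i) → countFin P ≡ countFin Q
countFin-cong {zero}  e = refl
countFin-cong {suc n} e = cong₂ _+_ (cong indicator (e zero)) (countFin-cong (e ∘ suc))

countFin-mono : ∀ {n} {P Q : Subset n} → P ⊆ Q → countFin P ≤ countFin Q
countFin-mono {zero}  h = z≤n
countFin-mono {suc n} h = +-mono-≤ (indicator-mono (h zero)) (countFin-mono (h ∘ suc))

countFin-∅ : ∀ n → countFin {n} (λ _ → false) ≡ 0
countFin-∅ zero    = refl
countFin-∅ (suc n) = countFin-∅ n

countFin-zero : ∀ {n} (P : Subset n) → countFin P ≡ 0 → ∀ i → P i ≡ false
countFin-zero P e zero    with P zero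
... | false = refl
countFin-zero P e (suc i) with P zero
... | false = countFin-zero (P ∘ suc) e i

countFin-witness : ∀ {n} (P : Subset n) → 0 < countFin P → ∃ λ i → P i ≡ true
countFin-witness {suc n} P h with P zero in eq
... | true  = zero , eq
... | false = let (i , Pi) = countFin-witness (P ∘ suc) h in suc i , Pi

countFin-⊂ : ∀ {n} {T S : Subset n} → T ⊂ S → countFin T < countFin S
countFin-⊂ {T = T} {S} (T⊆S , zero , Tj , Sj) rewrite Tj | Sj = s≤s (countFin-mono (T⊆S ∘ suc))
countFin-⊂ {T = T} {S} (T⊆S , suc j , Tj , Sj) =
  +-mono-≤-< (indicator-mono (T⊆S zero)) (countFin-⊂ (T⊆S ∘ suc , j , Tj , Sj))

countFin-remove : ∀ {n} (U : Subset n) j → U j ≡ true → suc (countFin (U ∖ ⁅ j ⁆)) ≡ countFin U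
countFin-remove {suc n} U zero Uj rewrite Uj =
  cong suc (countFin-cong (λ i → ∧-identityʳ (U (suc i))))
countFin-remove {suc n} U (suc j) Uj with U zero
... | true  = cong suc (countFin-remove (U ∘ suc) j Uj)
... | false = countFin-remove (U ∘ suc) j Uj

countFin-∪ : ∀ {n} (P Q : Subset n) → countFin (P ∪ Q) ≤ countFin P + countFin Q
countFin-∪ {zero}  P Q = z≤n
countFin-∪ {suc n} P Q = begin
  indicator (P zero ∨ Q zero) + countFin ((P ∪ Q) ∘ suc)
    ≤⟨ +-mono-≤ (indicator-∨ (P zero) (Q zero)) (countFin-∪ (P ∘ suc) (Q ∘ suc)) ⟩
  indicator (P zero) + indicator (Q zero) + (countFin (P ∘ suc) + countFin (Q ∘ suc))
    ≡⟨ +-interchange (indicator (P zero)) _ _ _ ⟩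
  indicator (P zero) + countFin (P ∘ suc) + (indicator (Q zero) + countFin (Q ∘ suc)) ∎
  where open ≤-Reasoning

countFin-some : ∀ {m n} (Q : Fin m → Subset n) →
  countFin (λ w → some (λ u → Q u w)) ≤ sumFin (λ u → countFin (Q u))
countFin-some {zero}  {n} Q = ≤-reflexive (countFin-∅ n)
countFin-some {suc m}     Q = ≤-trans (countFin-∪ (Q zero) (λ w → some (λ u → Q (suc u) w)))
  (+-monoʳ-≤ (countFin (Q zero)) (countFin-some (Q ∘ suc)))

sumFin-mono : ∀ {n} {f g : Fin n → ℕ} → (∀ i → f i ≤ g i) → sumFin f ≤ sumFin g
sumFin-mono {zero}  h = z≤n
sumFin-mono {suc n} h = +-mono-≤ (h zero) (sumFin-mono (h ∘ suc))

sumFin-indicator : ∀ {n} (P : Subset n) c → sumFin (λ i → indicator (P i) * c) ≡ countFin P * c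
sumFin-indicator {zero}  P c = refl
sumFin-indicator {suc n} P c =
  trans (cong (indicator (P zero) * c +_) (sumFin-indicator (P ∘ suc) c))
        (sym (*-distribʳ-+ c (indicator (P zero)) (countFin (P ∘ suc))))

Colouring : ℕ → Set
Colouring n = Fin n → Bool

extend : ∀ {n} → Bool → Colouring n → Colouring (suc n)
extend b c zero    = b
extend b c (suc i) = c i

noColouring : Colouring 0
noColouring ()

countCol : ∀ n → (Colouring n → Bool) → ℕ
countCol zero    P = indicator (P noColouring)
countCol (suc n) P = countCol n (P ∘ extend false) + countCol n (P ∘ extend true)

countCol-cong : ∀ n {P Q : Colouring n → Bool} → (∀ c → P c ≡ Q c) → countCol n P ≡ countCol n Q
countCol-cong zero    e = cong indicator (e noColouring)
countCol-cong (suc n) e = cong₂ _+_ (countCol-cong n (e ∘ extend false)) (countCol-cong n (e ∘ extend true))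

countCol-all : ∀ n → countCol n (λ _ → true) ≡ 2 ^ n
countCol-all zero    = refl
countCol-all (suc n) = cong₂ _+_ (countCol-all n) (trans (countCol-all n) (sym (+-identityʳ (2 ^ n))))

countCol-none : ∀ n → countCol n (λ _ → false) ≡ 0
countCol-none zero    = refl
countCol-none (suc n) = cong₂ _+_ (countCol-none n) (countCol-none n)

countCol-mono : ∀ n {P Q : Colouring n → Bool} → (∀ c → P c ≡ true → Q c ≡ true) →
  countCol n P ≤ countCol n Q
countCol-mono zero    h = indicator-mono (h noColouring)
countCol-mono (suc n) h = +-mono-≤ (countCol-mono n (h ∘ extend false)) (countCol-mono n (h ∘ extend true))

countCol-split : ∀ n (P Q : Colouring n → Bool) →
  countCol n P ≡ countCol n (λ c → P c ∧ Q c) + countCol n (λ c → P c ∧ not (Q c))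
countCol-split zero    P Q with P noColouring | Q noColouring
... | true  | true  = refl
... | true  | false = refl
... | false | _     = refl
countCol-split (suc n) P Q =
  trans (cong₂ _+_ (countCol-split n (P ∘ extend false) (Q ∘ extend false))
                   (countCol-split n (P ∘ extend true) (Q ∘ extend true)))
        (+-interchange (both false) (onlyP false) (both true) (onlyP true))
  where both onlyP : Bool → ℕ
        both  b = countCol n (λ c → P (extend b c) ∧ Q (extend b c))
        onlyP b = countCol n (λ c → P (extend b c) ∧ not (Q (extend b c)))

countCol-∨ : ∀ n (P Q : Colouring n → Bool) →
  countCol n (λ c → P c ∨ Q c) ≤ countCol n P + countCol n Q
countCol-∨ zero    P Q = indicator-∨ (P noColouring) (Q noColouring)
countCol-∨ (suc n) P Q =
  ≤-trans (+-mono-≤ (countCol-∨ n (P ∘ extend false) (Q ∘ extend false))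
                    (countCol-∨ n (P ∘ extend true) (Q ∘ extend true)))
          (≤-reflexive (+-interchange (#P false) (#Q false) (#P true) (#Q true)))
  where #P #Q : Bool → ℕ
        #P b = countCol n (P ∘ extend b)
        #Q b = countCol n (Q ∘ extend b)

countCol-witness : ∀ n (P : Colouring n → Bool) → 0 < countCol n P → ∃ λ c → P c ≡ true
countCol-witness zero P h with P noColouring in eq
... | true = noColouring , eq
countCol-witness (suc n) P h with countCol n (P ∘ extend false) in eq
... | suc _ = let (c , Pc) = countCol-witness n (P ∘ extend false) (subst (0 <_) (sym eq) (s≤s z≤n))
              in extend false c , Pc
... | zero  = let (c , Pc) = countCol-witness n (P ∘ extend true) h in extend true c , Pc

halves-sum : ∀ X₁ X₂ F₁ F₂ p q → X₁ * p ≡ F₁ * q → X₂ * p ≡ F₂ * q →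
  (X₁ + X₂) * (2 * p) ≡ (F₁ + F₂) * (2 * q)
halves-sum X₁ X₂ F₁ F₂ p q e₁ e₂ = begin
  (X₁ + X₂) * (2 * p)         ≡⟨ distribute X₁ X₂ p ⟩
  2 * (X₁ * p) + 2 * (X₂ * p) ≡⟨ cong₂ (λ x y → 2 * x + 2 * y) e₁ e₂ ⟩
  2 * (F₁ * q) + 2 * (F₂ * q) ≡⟨ sym (distribute F₁ F₂ q) ⟩
  (F₁ + F₂) * (2 * q)         ∎
  where open ≡-Reasoning
        distribute : ∀ x y z → (x + y) * (2 * z) ≡ 2 * (x * z) + 2 * (y * z)
        distribute = solve-∀

halves-equal : ∀ X F p q → X * p ≡ F * q → (X + X) * p ≡ F * (2 * q)
halves-equal X F p q e = begin
  (X + X) * p   ≡⟨ double X p ⟩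
  2 * (X * p)   ≡⟨ cong (2 *_) e ⟩
  2 * (F * q)   ≡⟨ *-comm 2 (F * q) ⟩
  F * q * 2     ≡⟨ *-assoc F q 2 ⟩
  F * (q * 2)   ≡⟨ cong (F *_) (*-comm q 2) ⟩
  F * (2 * q)   ∎
  where open ≡-Reasoning
        double : ∀ x y → (x + x) * y ≡ 2 * (x * y)
        double = solve-∀

DependsOn : ∀ {n} → Subset n → (Colouring n → Bool) → Set
DependsOn {n} T P = ∀ (c c' : Colouring n) → (∀ i → T i ≡ true → c i ≡ c' i) → P c ≡ P c'

dependsOn-tail : ∀ {n} {T : Subset (suc n)} {P : Colouring (suc n) → Bool} →
  DependsOn T P → ∀ b → DependsOn (T ∘ suc) (P ∘ extend b)
dependsOn-tail h b c c' agree = h (extend b c) (extend b c') agreeExtended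
  where agreeExtended : ∀ i → _ → extend b c i ≡ extend b c' i
        agreeExtended zero    _ = refl
        agreeExtended (suc i) t = agree i t

dependsOn-head : ∀ {n} {T : Subset (suc n)} {P : Colouring (suc n) → Bool} →
  DependsOn T P → T zero ≡ false → ∀ c → P (extend true c) ≡ P (extend false c)
dependsOn-head {T = T} h T0 c = h (extend true c) (extend false c) agreeOffHead
  where agreeOffHead : ∀ i → T i ≡ true → extend true c i ≡ extend false c i
        agreeOffHead zero    t = ⊥-elim (true≢false (trans (sym t) T0))
        agreeOffHead (suc i) _ = refl

dependsOn-complement : ∀ {n} {T : Subset n} {P : Colouring n → Bool} →
  DependsOn T P → DependsOn (not ∘ not ∘ T) P
dependsOn-complement {T = T} h c c' agree = h c c' (λ i t → agree i (trans (not-involutive (T i)) t))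

IndependenceAt : ℕ → Set
IndependenceAt n = ∀ (T : Subset n) (P Q : Colouring n → Bool) →
  DependsOn T P → DependsOn (not ∘ T) Q →
  countCol n (λ c → P c ∧ Q c) * 2 ^ n ≡ countCol n P * countCol n Q

-- The inductive step when coordinate 0 does not influence Q: both halves of
-- the count use the same Q-part, and independence in dimension n applies.
independence-step : ∀ n → IndependenceAt n →
  ∀ (T : Subset (suc n)) (P Q : Colouring (suc n) → Bool) →
  DependsOn T P → DependsOn (not ∘ T) Q → (∀ c → Q (extend true c) ≡ Q (extend false c)) →
  countCol (suc n) (λ c → P c ∧ Q c) * 2 ^ suc n ≡ countCol (suc n) P * countCol (suc n) Q
independence-step n indep T P Q hP hQ Q-headFree = begin
  (# P₀∧Q₀ + # (λ c → P₁ c ∧ Q (extend true c))) * (2 * 2 ^ n)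
    ≡⟨ cong (λ z → (# P₀∧Q₀ + z) * (2 * 2 ^ n)) (countCol-cong n (λ c → cong (P₁ c ∧_) (Q-headFree c))) ⟩
  (# P₀∧Q₀ + # P₁∧Q₀) * (2 * 2 ^ n)
    ≡⟨ halves-sum (# P₀∧Q₀) (# P₁∧Q₀) (# P₀) (# P₁) (2 ^ n) (# Q₀)
         (indep (T ∘ suc) P₀ Q₀ (dependsOn-tail hP false) (dependsOn-tail hQ false))
         (indep (T ∘ suc) P₁ Q₀ (dependsOn-tail hP true) (dependsOn-tail hQ false)) ⟩
  (# P₀ + # P₁) * (2 * # Q₀)
    ≡⟨ cong (λ z → (# P₀ + # P₁) * (# Q₀ + z)) (trans (+-identityʳ (# Q₀)) (sym (countCol-cong n Q-headFree))) ⟩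
  (# P₀ + # P₁) * (# Q₀ + # (Q ∘ extend true)) ∎
  where
  open ≡-Reasoning
  # : (Colouring n → Bool) → ℕ
  # = countCol n
  P₀ P₁ Q₀ P₀∧Q₀ P₁∧Q₀ : Colouring n → Bool
  P₀ = P ∘ extend false
  P₁ = P ∘ extend true
  Q₀ = Q ∘ extend false
  P₀∧Q₀ c = P₀ c ∧ Q₀ c
  P₁∧Q₀ c = P₁ c ∧ Q₀ c

independence : ∀ n → IndependenceAt n
independence zero    T P Q hP hQ = trans (*-identityʳ _) (indicator-∧ (P noColouring) (Q noColouring))
  where indicator-∧ : ∀ x y → indicator (x ∧ y) ≡ indicator x * indicator y
        indicator-∧ true  y = sym (+-identityʳ _)
        indicator-∧ false y = refl
independence (suc n) T P Q hP hQ with T zero in T0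
... | true  = independence-step n (independence n) T P Q hP hQ (dependsOn-head hQ (cong not T0))
... | false = begin
  countCol (suc n) (λ c → P c ∧ Q c) * 2 ^ suc n
    ≡⟨ cong (_* 2 ^ suc n) (countCol-cong (suc n) (λ c → ∧-comm (P c) (Q c))) ⟩
  countCol (suc n) (λ c → Q c ∧ P c) * 2 ^ suc n
    ≡⟨ independence-step n (independence n) (not ∘ T) Q P hQ (dependsOn-complement hP)
                         (dependsOn-head hP T0) ⟩
  countCol (suc n) Q * countCol (suc n) P
    ≡⟨ *-comm (countCol (suc n) Q) _ ⟩
  countCol (suc n) P * countCol (suc n) Q ∎
  where open ≡-Reasoning

-- lowerTail m k = Σ_{i<k} (m choose i), the number of subsets of an m-set
-- with fewer than k elements, given by Pascal's rule.
lowerTail : ℕ → ℕ → ℕ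
lowerTail zero    zero    = 0
lowerTail zero    (suc k) = 1
lowerTail (suc m) zero    = 0
lowerTail (suc m) (suc k) = lowerTail m (suc k) + lowerTail m k

hasColour : Bool → Bool → Bool
hasColour true  b = b
hasColour false b = not b

colourCount : ∀ {n} → Subset n → Bool → Colouring n → ℕ
colourCount N j c = countFin (λ u → N u ∧ hasColour j (c u))

fewColoured : ∀ {n} → Subset n → Bool → ℕ → Colouring n → Bool
fewColoured N j k c = colourCount N j c <ᵇ k

fewColoured-count : ∀ n (N : Subset n) j k →
  countCol n (fewColoured N j k) * 2 ^ countFin N ≡ lowerTail (countFin N) k * 2 ^ n
fewColoured-count zero    N j zero    = refl
fewColoured-count zero    N j (suc k) = refl
fewColoured-count (suc n) N j k with N zero
... | false = halves-equal (countCol n (fewColoured (N ∘ suc) j k)) (lowerTail (countFin (N ∘ suc)) k)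
                           (2 ^ countFin (N ∘ suc)) (2 ^ n) (fewColoured-count n (N ∘ suc) j k)
... | true  = pascal j k
  where
  N' : Subset n
  N' = N ∘ suc
  m : ℕ
  m = countFin N'
  few : Bool → ℕ → ℕ
  few j k = countCol n (fewColoured N' j k)
  -- Colouring coordinate 0 with j shifts the count by one: Pascal's rule.
  pascal : ∀ j k →
    (countCol n (λ c → (indicator (hasColour j false) + colourCount N' j c) <ᵇ k)
     + countCol n (λ c → (indicator (hasColour j true) + colourCount N' j c) <ᵇ k)) * (2 * 2 ^ m)
    ≡ lowerTail (suc m) k * (2 * 2 ^ n)
  pascal true  zero    rewrite countCol-none n = refl
  pascal false zero    rewrite countCol-none n = refl
  pascal true  (suc k) = halves-sum (few true (suc k)) (few true k) (lowerTail m (suc k)) (lowerTail m k)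
    (2 ^ m) (2 ^ n) (fewColoured-count n N' true (suc k)) (fewColoured-count n N' true k)
  pascal false (suc k) = trans
    (halves-sum (few false k) (few false (suc k)) (lowerTail m k) (lowerTail m (suc k))
      (2 ^ m) (2 ^ n) (fewColoured-count n N' false k) (fewColoured-count n N' false (suc k)))
    (cong (_* (2 * 2 ^ n)) (+-comm (lowerTail m k) (lowerTail m (suc k))))

remainder-bound : ∀ a c X Y → (a + c) * X ≤ a * (X + Y) → c * (X + Y) ≤ (a + c) * Y
remainder-bound a c X Y h = +-cancelˡ-≤ (a * (X + Y)) _ _ (begin
  a * (X + Y) + c * (X + Y) ≡⟨ sym (*-distribʳ-+ (X + Y) a c) ⟩
  (a + c) * (X + Y)         ≡⟨ *-distribˡ-+ (a + c) X Y ⟩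
  (a + c) * X + (a + c) * Y ≤⟨ +-monoˡ-≤ ((a + c) * Y) h ⟩
  a * (X + Y) + (a + c) * Y ∎)
  where open ≤-Reasoning

ratio-extend : ∀ {b c} k D Z Y → c ≤ b → k ≤ D → c ^ k * Z ≤ b ^ k * Y → c ^ D * Z ≤ b ^ D * Y
ratio-extend {b} {c} k D Z Y c≤b k≤D h with (e , refl) ← m≤n⇒∃[o]m+o≡n k≤D = begin
  c ^ (k + e) * Z     ≡⟨ cong (_* Z) (trans (^-distribˡ-+-* c k e) (*-comm (c ^ k) (c ^ e))) ⟩
  c ^ e * c ^ k * Z   ≡⟨ *-assoc (c ^ e) (c ^ k) Z ⟩
  c ^ e * (c ^ k * Z) ≤⟨ *-mono-≤ (^-monoˡ-≤ e c≤b) h ⟩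
  b ^ e * (b ^ k * Y) ≡⟨ sym (*-assoc (b ^ e) (b ^ k) Y) ⟩
  b ^ e * b ^ k * Y   ≡⟨ cong (_* Y) (trans (*-comm (b ^ e) (b ^ k)) (sym (^-distribˡ-+-* b k e))) ⟩
  b ^ (k + e) * Y     ∎
  where open ≤-Reasoning

-- The arithmetic of one conditional bound: with P(A) = PA/N ≤ (a/b)(c/b)^D,
-- X ≤ X₂ = PA·Z/N and Z/Y ≤ (b/c)^D we get X/Y ≤ a/b.
conditional-arith : ∀ a b c D X X₂ PA Z Y N .{{_ : NonZero N}} .{{_ : NonZero b}} →
  X ≤ X₂ → X₂ * N ≡ PA * Z → PA * b ^ suc D ≤ a * c ^ D * N → c ^ D * Z ≤ b ^ D * Y →
  b * X ≤ a * Y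
conditional-arith a b c D X X₂ PA Z Y N X≤X₂ X₂N≡PAZ PA-rare ZY-ratio =
  *-cancelʳ-≤ (b * X) (a * Y) (b ^ D) {{m^n≢0 b D}} (begin
    b * X * b ^ D     ≤⟨ *-cancelʳ-≤ _ _ N scaled ⟩
    a * c ^ D * Z     ≡⟨ *-assoc a (c ^ D) Z ⟩
    a * (c ^ D * Z)   ≤⟨ *-monoʳ-≤ a ZY-ratio ⟩
    a * (b ^ D * Y)   ≡⟨ trans (sym (*-assoc a (b ^ D) Y)) (swap a (b ^ D) Y) ⟩
    a * Y * b ^ D     ∎)
  where
  open ≤-Reasoning
  swap : ∀ x y z → x * y * z ≡ x * z * y
  swap = solve-∀
  scaled : b * X * b ^ D * N ≤ a * c ^ D * Z * N
  scaled = begin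
    b * X * b ^ D * N     ≡⟨ regroup₁ b X (b ^ D) N ⟩
    b * b ^ D * (X * N)   ≤⟨ *-monoʳ-≤ (b * b ^ D) (*-monoˡ-≤ N X≤X₂) ⟩
    b * b ^ D * (X₂ * N)  ≡⟨ cong (b * b ^ D *_) X₂N≡PAZ ⟩
    b * b ^ D * (PA * Z)  ≡⟨ regroup₂ (b * b ^ D) PA Z ⟩
    PA * (b * b ^ D) * Z  ≤⟨ *-monoˡ-≤ Z PA-rare ⟩
    a * c ^ D * N * Z     ≡⟨ swap (a * c ^ D) N Z ⟩
    a * c ^ D * Z * N     ∎
    where regroup₁ : ∀ x y z w → x * y * z * w ≡ x * z * (y * w)
          regroup₁ = solve-∀
          regroup₂ : ∀ x y z → x * (y * z) ≡ y * x * z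
          regroup₂ = solve-∀

-- Bad events A i (i : Fin m) on
-- colourings of n coordinates; A i depends only on the coordinates scope i;
-- events that are not dependent have disjoint scopes; each event has at most
-- D dependent ones; and P(A i) ≤ x(1-x)^D for x = a/(a+c).
module LocalLemma {m n : ℕ} (A : Fin m → Colouring n → Bool) (scope : Fin m → Subset n)
  (dependent : Fin m → Subset m) (a c D : ℕ) (0<c : 0 < c)
  (A-local : ∀ i → DependsOn (scope i) (A i))
  (scopes-disjoint : ∀ i w → dependent i w ≡ false → ∀ u → scope w u ≡ true → scope i u ≡ false)
  (few-dependent : ∀ i → countFin (dependent i) ≤ D)
  (A-rare : ∀ i → countCol n (A i) * (a + c) ^ suc D ≤ a * c ^ D * 2 ^ n) where

  b : ℕ
  b = a + c

  instance
    b≢0 : NonZero b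
    b≢0 = >-nonZero (≤-trans 0<c (m≤n+m c a))

  avoids : Subset m → Colouring n → Bool
  avoids S col = every (λ w → not (S w ∧ A w col))

  CondBound : Subset m → Fin m → Set
  CondBound S i = b * countCol n (λ col → A i col ∧ avoids S col) ≤ a * countCol n (avoids S)

  CondBoundsBelow : Subset m → Set
  CondBoundsBelow R = ∀ T → T ⊂ R → ∀ i → CondBound T i

  condBoundsBelow-⊆ : ∀ {R S} → R ⊆ S → CondBoundsBelow S → CondBoundsBelow R
  condBoundsBelow-⊆ R⊆S below T (T⊆R , j , Tj , Rj) = below T ((λ w → R⊆S w ∘ T⊆R w) , j , Tj , R⊆S j Rj)

  avoids-elim : ∀ S col w → avoids S col ≡ true → S w ≡ true → A w col ≡ false
  avoids-elim S col w h Sw with every-elim _ h w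
  ... | notA rewrite Sw = not-true notA

  avoids-antitone : ∀ {T S} col → T ⊆ S → avoids S col ≡ true → avoids T col ≡ true
  avoids-antitone {T} {S} col T⊆S h = every-intro _ avoidsEach
    where avoidsEach : ∀ w → not (T w ∧ A w col) ≡ true
          avoidsEach w with T w in Tw
          ... | false = refl
          ... | true rewrite avoids-elim S col w h (T⊆S w Tw) = refl

  avoids-cong : ∀ {T S} → (∀ w → T w ≡ S w) → ∀ col → avoids T col ≡ avoids S col
  avoids-cong e col = every-cong (λ w → cong (λ z → not (z ∧ A w col)) (e w))

  avoids-insert : ∀ R j col → avoids (R ∪ ⁅ j ⁆) col ≡ avoids R col ∧ not (A j col)
  avoids-insert R j col = bool-ext forward backward
    where
    j∈ : (R ∪ ⁅ j ⁆) j ≡ true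
    j∈ = trans (cong (R j ∨_) (dec-true (j ≟ j) refl)) (∨-zeroʳ (R j))
    forward : avoids (R ∪ ⁅ j ⁆) col ≡ true → avoids R col ∧ not (A j col) ≡ true
    forward h rewrite avoids-antitone {R} col (λ w Rw → cong (_∨ ⁅ j ⁆ w) Rw) h
                    | avoids-elim (R ∪ ⁅ j ⁆) col j h j∈ = refl
    backward : avoids R col ∧ not (A j col) ≡ true → avoids (R ∪ ⁅ j ⁆) col ≡ true
    backward h = every-intro _ avoidsEach
      where
      avoidsEach : ∀ w → not ((R w ∨ ⁅ j ⁆ w) ∧ A w col) ≡ true
      avoidsEach w with R w in Rw | w ≟ j
      ... | true  | _        rewrite avoids-elim R col w (∧-conicalˡ _ _ h) Rw = refl
      ... | false | yes refl rewrite not-true (∧-conicalʳ (avoids R col) _ h) = refl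
      ... | false | no _     = refl

  avoids-local : ∀ S T → (∀ w → S w ≡ true → scope w ⊆ T) → DependsOn T (avoids S)
  avoids-local S T scopes⊆T col col' agree = every-cong sameOnEach
    where sameOnEach : ∀ w → not (S w ∧ A w col) ≡ not (S w ∧ A w col')
          sameOnEach w with S w in Sw
          ... | false = refl
          ... | true  = cong not (A-local w col col' (λ u su → agree u (scopes⊆T w Sw u su)))

  survival-step : ∀ R j → CondBound R j →
    c * countCol n (avoids R) ≤ b * countCol n (avoids (R ∪ ⁅ j ⁆))
  survival-step R j bound =
    subst₂ (λ total rest → c * total ≤ b * rest) (sym split) (countCol-cong n (λ col → sym (avoids-insert R j col)))
      (remainder-bound a c hit miss
        (subst₂ (λ h t → b * h ≤ a * t) (countCol-cong n (λ col → ∧-comm (A j col) (avoids R col))) split bound))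
    where
    hit miss : ℕ
    hit  = countCol n (λ col → avoids R col ∧ A j col)
    miss = countCol n (λ col → avoids R col ∧ not (A j col))
    split : countCol n (avoids R) ≡ hit + miss
    split = countCol-split n (avoids R) (λ col → A j col)

  product-bound : ∀ k (S U : Subset m) → countFin U ≡ k → (∀ w → U w ≡ true → S w ≡ false) →
    CondBoundsBelow (S ∪ U) → c ^ k * countCol n (avoids S) ≤ b ^ k * countCol n (avoids (S ∪ U))
  product-bound zero S U |U|≡0 _ _ = ≤-reflexive (cong (_+ 0) (countCol-cong n (avoids-cong nothingAdded)))
    where nothingAdded : ∀ w → S w ≡ (S ∪ U) w
          nothingAdded w = sym (trans (cong (S w ∨_) (countFin-zero U |U|≡0 w)) (∨-identityʳ (S w)))
  product-bound (suc k) S U |U|≡1+k disjoint below = begin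
    c ^ suc k * Z    ≡⟨ *-assoc c (c ^ k) Z ⟩
    c * (c ^ k * Z)  ≤⟨ *-monoʳ-≤ c earlier ⟩
    c * (b ^ k * Y') ≡⟨ left-comm c (b ^ k) Y' ⟩
    b ^ k * (c * Y') ≤⟨ *-monoʳ-≤ (b ^ k) last ⟩
    b ^ k * (b * Y)  ≡⟨ trans (left-comm (b ^ k) b Y) (sym (*-assoc b (b ^ k) Y)) ⟩
    b ^ suc k * Y    ∎
    where
    open ≤-Reasoning
    left-comm : ∀ x y z → x * (y * z) ≡ y * (x * z)
    left-comm = solve-∀
    j∈U : ∃ λ j → U j ≡ true
    j∈U = countFin-witness U (subst (0 <_) (sym |U|≡1+k) (s≤s z≤n))
    j : Fin m
    j = proj₁ j∈U
    Uj : U j ≡ true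
    Uj = proj₂ j∈U
    R' : Subset m
    R' = S ∪ U ∖ ⁅ j ⁆
    Z Y Y' : ℕ
    Z  = countCol n (avoids S)
    Y  = countCol n (avoids (S ∪ U))
    Y' = countCol n (avoids R')
    R'⊂S∪U : R' ⊂ S ∪ U
    R'⊂S∪U = ∪-monoʳ-⊆ S ∖-⊆ , j , j∉R' , j∈S∪U
      where j∉R' : R' j ≡ false
            j∉R' rewrite disjoint j Uj | Uj | dec-true (j ≟ j) refl = refl
            j∈S∪U : (S ∪ U) j ≡ true
            j∈S∪U rewrite Uj = ∨-zeroʳ (S j)
    earlier : c ^ k * Z ≤ b ^ k * Y'
    earlier = product-bound k S (U ∖ ⁅ j ⁆) (suc-injective (trans (countFin-remove U j Uj) |U|≡1+k))
      (λ w U'w → disjoint w (∧-conicalˡ _ _ U'w)) (condBoundsBelow-⊆ (proj₁ R'⊂S∪U) below)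
    last : c * Y' ≤ b * Y
    last = subst (λ t → c * Y' ≤ b * t) (countCol-cong n (avoids-cong (λ w → sym (reinsert S U j Uj w))))
      (survival-step R' j (below R' R'⊂S∪U j))

  -- One conditional bound from those below S: split S into the events
  -- dependent on i (at most D of them) and the rest, which is independent of A i.
  condBound-step : ∀ S i → CondBoundsBelow S → CondBound S i
  condBound-step S i below = conditional-arith a b c D X X₂ (countCol n (A i)) Z Y (2 ^ n) {{m^n≢0 2 n}}
    X≤X₂ A-independent (A-rare i) (ratio-extend k D Z Y (m≤n+m c a) k≤D product)
    where
    S₁ S₂ : Subset m
    S₁ = S ∩ dependent i
    S₂ = S ∖ dependent i
    k X X₂ Z Y : ℕ
    k  = countFin S₁
    X  = countCol n (λ col → A i col ∧ avoids S col)
    X₂ = countCol n (λ col → A i col ∧ avoids S₂ col)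
    Z  = countCol n (avoids S₂)
    Y  = countCol n (avoids S)
    S≡S₂∪S₁ : ∀ w → S w ≡ (S₂ ∪ S₁) w
    S≡S₂∪S₁ = split-by S (dependent i)
    X≤X₂ : X ≤ X₂
    X≤X₂ = countCol-mono n (λ col h → ∧-intro (∧-conicalˡ _ _ h) (avoids-antitone col ∖-⊆ (∧-conicalʳ (A i col) _ h)))
    A-independent : X₂ * 2 ^ n ≡ countCol n (A i) * Z
    A-independent = independence n (scope i) (A i) (avoids S₂) (A-local i)
      (avoids-local S₂ (not ∘ scope i)
        (λ w S₂w u su → cong not (scopes-disjoint i w (not-true (∧-conicalʳ (S w) _ S₂w)) u su)))
    product : c ^ k * Z ≤ b ^ k * Y
    product = subst (λ t → c ^ k * Z ≤ b ^ k * t) (countCol-cong n (avoids-cong (λ w → sym (S≡S₂∪S₁ w))))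
      (product-bound k S₂ S₁ refl
        (λ w S₁w → trans (cong (λ x → S w ∧ not x) (∧-conicalʳ (S w) _ S₁w)) (∧-zeroʳ (S w)))
        (condBoundsBelow-⊆ (λ w → subst (_≡ true) (sym (S≡S₂∪S₁ w))) below))
    k≤D : k ≤ D
    k≤D = ≤-trans (countFin-mono (λ w → ∧-conicalʳ (S w) _)) (few-dependent i)

  condBound-bounded : ∀ N S → countFin S < N → ∀ i → CondBound S i
  condBound-bounded (suc N) S |S|<1+N i = condBound-step S i
    (λ T T⊂S → condBound-bounded N T (<-≤-trans (countFin-⊂ T⊂S) (≤-pred |S|<1+N)))

  condBound : ∀ S i → CondBound S i
  condBound S = condBound-bounded (suc (countFin S)) S ≤-refl

  -- Conditioning on all m events: P(avoids everything) ≥ (c/b)^m > 0.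
  local-lemma : ∃ λ col → ∀ i → A i col ≡ false
  local-lemma = col , λ i → avoids-elim everything col i avoidsAll refl
    where
    everything : Subset m
    everything _ = true
    k Y : ℕ
    k = countFin everything
    Y = countCol n (avoids everything)
    instance
      c≢0 : NonZero c
      c≢0 = >-nonZero 0<c
    avoidNone : countCol n (avoids (λ _ → false)) ≡ 2 ^ n
    avoidNone = trans (countCol-cong n (λ col → every-intro {m} _ (λ _ → refl))) (countCol-all n)
    product : c ^ k * 2 ^ n ≤ b ^ k * Y
    product = subst (λ t → c ^ k * t ≤ b ^ k * Y) avoidNone
      (product-bound k (λ _ → false) everything refl (λ _ _ → refl) (λ T _ → condBound T))
    0<lhs : 0 < c ^ k * 2 ^ n
    0<lhs = >-nonZero⁻¹ _ {{m*n≢0 (c ^ k) (2 ^ n) {{m^n≢0 c k}} {{m^n≢0 2 n}}}}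
    0<Y : 0 < Y
    0<Y = >-nonZero⁻¹ Y {{m*n≢0⇒n≢0 (b ^ k) {{>-nonZero (<-≤-trans 0<lhs product)}}}}
    witness : ∃ λ col → avoids everything col ≡ true
    witness = countCol-witness n (avoids everything) 0<Y
    col : Colouring n
    col = proj₁ witness
    avoidsAll : avoids everything col ≡ true
    avoidsAll = proj₂ witness

Balanced : ∀ {n} → Graph n → ℕ → Set
Balanced {n} G k = Σ (VSet n) λ V₀ → ∀ v → k ≤ degIn G V₀ v × k ≤ degIn G (compl V₀) v

<ᵇ-false⇒≥ : ∀ x k → (x <ᵇ k) ≡ false → k ≤ x
<ᵇ-false⇒≥ x k e = ≮⇒≥ (λ x<k → subst T e (<⇒<ᵇ x<k))

-- The Local Lemma applied to a d-regular graph, with the bad event of a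
-- vertex v being "fewer than k neighbours of v have some colour".  The scope
-- of this event is the neighbourhood of v, two events are dependent when
-- their vertices have a common neighbour, so each has at most d² dependent
-- ones; the condition below is P(bad) ≤ x(1-x)^(d²) with x = a/(a+c).
module BalancedColouring {n} (G : Graph n) (d : ℕ) (regular : Regular G d) (k a c : ℕ) (0<c : 0 < c)
  (condition : 2 * lowerTail d k * (a + c) ^ suc (d * d) ≤ a * c ^ (d * d) * 2 ^ d) where

  neighbours : Fin n → Subset n
  neighbours v u = adj G u v

  degIn-countFin : ∀ S v → degIn G S v ≡ countFin (neighbours v ∩ S)
  degIn-countFin S v = length-filter-tabulate id (λ u → adj G u v ∧ S u)

  |neighbours| : ∀ v → countFin (neighbours v) ≡ d
  |neighbours| v = trans (countFin-cong (λ u → sym (∧-identityʳ (adj G u v))))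
                         (trans (sym (degIn-countFin (λ _ → true) v)) (regular v))

  out-degree : ∀ u → countFin (adj G u) ≡ d
  out-degree u = trans (countFin-cong (Graph.sym G u)) (|neighbours| u)

  bad : Fin n → Colouring n → Bool
  bad v col = fewColoured (neighbours v) true k col ∨ fewColoured (neighbours v) false k col

  dependent : Fin n → Subset n
  dependent v w = some (λ u → adj G u v ∧ adj G u w)

  bad-local : ∀ v → DependsOn (neighbours v) (bad v)
  bad-local v col col' agree = cong₂ (λ x y → (x <ᵇ k) ∨ (y <ᵇ k)) (sameCount true) (sameCount false)
    where sameCount : ∀ j → colourCount (neighbours v) j col ≡ colourCount (neighbours v) j col'
          sameCount j = countFin-cong sameTerm
            where sameTerm : ∀ u → adj G u v ∧ hasColour j (col u) ≡ adj G u v ∧ hasColour j (col' u)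
                  sameTerm u with adj G u v in uv
                  ... | true  = cong (hasColour j) (agree u uv)
                  ... | false = refl

  scopes-disjoint : ∀ v w → dependent v w ≡ false → ∀ u → adj G u w ≡ true → adj G u v ≡ false
  scopes-disjoint v w noCommon u uw =
    trans (sym (∧-identityʳ (adj G u v))) (subst (λ x → adj G u v ∧ x ≡ false) uw (some-false _ noCommon u))

  -- At most d² vertices share a neighbour with v: union bound over the d neighbours.
  few-dependent : ∀ v → countFin (dependent v) ≤ d * d
  few-dependent v = begin
    countFin (dependent v)                                   ≤⟨ countFin-some (λ u w → adj G u v ∧ adj G u w) ⟩
    sumFin (λ u → countFin (λ w → adj G u v ∧ adj G u w))   ≤⟨ sumFin-mono perNeighbour ⟩
    sumFin (λ u → indicator (adj G u v) * d)                 ≡⟨ sumFin-indicator (neighbours v) d ⟩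
    countFin (neighbours v) * d                               ≡⟨ cong (_* d) (|neighbours| v) ⟩
    d * d                                                     ∎
    where
    open ≤-Reasoning
    perNeighbour : ∀ u → countFin (λ w → adj G u v ∧ adj G u w) ≤ indicator (adj G u v) * d
    perNeighbour u with adj G u v
    ... | true  = ≤-reflexive (trans (out-degree u) (sym (+-identityʳ d)))
    ... | false = ≤-reflexive (countFin-∅ n)

  -- P(bad v) ≤ 2·lowerTail d k / 2^d, which the condition bounds.
  bad-rare : ∀ v → countCol n (bad v) * (a + c) ^ suc (d * d) ≤ a * c ^ (d * d) * 2 ^ n
  bad-rare v = *-cancelʳ-≤ _ _ (2 ^ d) {{m^n≢0 2 d}} (begin
    countCol n (bad v) * B * 2 ^ d
      ≤⟨ *-monoˡ-≤ (2 ^ d) (*-monoˡ-≤ B (countCol-∨ n (few true) (few false))) ⟩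
    (#few true + #few false) * B * 2 ^ d
      ≡⟨ regroup (#few true) (#few false) B (2 ^ d) ⟩
    (#few true * 2 ^ d + #few false * 2 ^ d) * B
      ≡⟨ cong₂ (λ x y → (x + y) * B) (tail true) (tail false) ⟩
    (lowerTail d k * 2 ^ n + lowerTail d k * 2 ^ n) * B
      ≡⟨ double (lowerTail d k) (2 ^ n) B ⟩
    2 * lowerTail d k * B * 2 ^ n
      ≤⟨ *-monoˡ-≤ (2 ^ n) condition ⟩
    a * c ^ (d * d) * 2 ^ d * 2 ^ n
      ≡⟨ swap (a * c ^ (d * d)) (2 ^ d) (2 ^ n) ⟩
    a * c ^ (d * d) * 2 ^ n * 2 ^ d ∎)
    where
    open ≤-Reasoning
    B : ℕ
    B = (a + c) ^ suc (d * d)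
    few : Bool → Colouring n → Bool
    few j = fewColoured (neighbours v) j k
    #few : Bool → ℕ
    #few j = countCol n (few j)
    tail : ∀ j → #few j * 2 ^ d ≡ lowerTail d k * 2 ^ n
    tail j = subst (λ t → #few j * 2 ^ t ≡ lowerTail t k * 2 ^ n) (|neighbours| v)
                   (fewColoured-count n (neighbours v) j k)
    regroup : ∀ x y z w → (x + y) * z * w ≡ (x * w + y * w) * z
    regroup = solve-∀
    double : ∀ x y z → (x * y + x * y) * z ≡ 2 * x * z * y
    double = solve-∀
    swap : ∀ x y z → x * y * z ≡ x * z * y
    swap = solve-∀

  open LocalLemma bad neighbours dependent a c (d * d) 0<c bad-local scopes-disjoint few-dependent bad-rare
    using (local-lemma)

  balanced : Balanced G k
  balanced = col , λ v → enough v true , enough v false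
    where
    col : Colouring n
    col = proj₁ local-lemma
    noneFew : ∀ v j → fewColoured (neighbours v) j k col ≡ false
    noneFew v true  = ∨-conicalˡ _ _ (proj₂ local-lemma v)
    noneFew v false = ∨-conicalʳ _ _ (proj₂ local-lemma v)
    enough : ∀ v j → k ≤ degIn G (λ u → hasColour j (col u)) v
    enough v j = subst (k ≤_) (sym (degIn-countFin _ v)) (<ᵇ-false⇒≥ _ k (noneFew v j))

lowerTail-0 : ∀ m → lowerTail m 0 ≡ 0
lowerTail-0 zero    = refl
lowerTail-0 (suc m) = refl

lowerTail-1 : ∀ m → lowerTail m 1 ≡ 1
lowerTail-1 zero    = refl
lowerTail-1 (suc m) = trans (cong (lowerTail m 1 +_) (lowerTail-0 m)) (trans (+-identityʳ _) (lowerTail-1 m))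

lowerTail-2 : ∀ m → lowerTail m 2 ≡ suc m
lowerTail-2 zero    = refl
lowerTail-2 (suc m) = trans (cong₂ _+_ (lowerTail-2 m) (lowerTail-1 m)) (+-comm (suc m) 1)

lowerTail-3 : ∀ m → 2 * lowerTail m 3 ≡ m * m + m + 2
lowerTail-3 zero    = refl
lowerTail-3 (suc m) = begin
  2 * (lowerTail m 3 + lowerTail m 2)     ≡⟨ *-distribˡ-+ 2 (lowerTail m 3) (lowerTail m 2) ⟩
  2 * lowerTail m 3 + 2 * lowerTail m 2   ≡⟨ cong₂ (λ x y → x + 2 * y) (lowerTail-3 m) (lowerTail-2 m) ⟩
  m * m + m + 2 + 2 * suc m               ≡⟨ expand m ⟩
  suc m * suc m + suc m + 2               ∎
  where open ≡-Reasoning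
        expand : ∀ m → m * m + m + 2 + 2 * suc m ≡ suc m * suc m + suc m + 2
        expand = solve-∀

bernoulli : ∀ p m t → suc p ≡ m + t → suc p ^ m * t ≤ p ^ m * suc p
bernoulli p zero    t e = ≤-reflexive (trans (+-identityʳ t) (trans (sym e) (sym (+-identityʳ (suc p)))))
bernoulli p (suc m) t e = begin
  suc p ^ suc m * t         ≡⟨ regroup (suc p) (suc p ^ m) t ⟩
  suc p ^ m * (suc p * t)   ≤⟨ *-monoʳ-≤ (suc p ^ m) shift ⟩
  suc p ^ m * (p * suc t)   ≡⟨ left-comm (suc p ^ m) p (suc t) ⟩
  p * (suc p ^ m * suc t)   ≤⟨ *-monoʳ-≤ p (bernoulli p m (suc t) (trans e (sym (+-suc m t)))) ⟩
  p * (p ^ m * suc p)       ≡⟨ sym (*-assoc p (p ^ m) (suc p)) ⟩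
  p ^ suc m * suc p         ∎
  where
  open ≤-Reasoning
  regroup : ∀ x y z → x * y * z ≡ y * (x * z)
  regroup = solve-∀
  left-comm : ∀ x y z → x * (y * z) ≡ y * (x * z)
  left-comm = solve-∀
  t≤p : t ≤ p
  t≤p = subst (t ≤_) (sym (suc-injective e)) (m≤n+m t m)
  shift : suc p * t ≤ p * suc t
  shift = begin
    t + p * t  ≤⟨ +-monoˡ-≤ (p * t) t≤p ⟩
    p + p * t  ≡⟨ sym (*-suc p t) ⟩
    p * suc t  ∎

-- With D = d², a = 1 and c = 2D - 1, so that x = 1/(2D), the Local Lemma
-- condition follows from 8·D·F ≤ 2^d, since (2D/(2D - 1))^D ≤ 2.
condition-large : ∀ d D' F → d * d ≡ suc D' → 8 * (d * d) * F ≤ 2 ^ d →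
  2 * F * (1 + (D' + suc D')) ^ suc (d * d) ≤ 1 * (D' + suc D') ^ (d * d) * 2 ^ d
condition-large d D' F dd≡D h rewrite dd≡D = begin
  2 * F * (2D * 2D ^ D)     ≡⟨ sym (*-assoc (2 * F) 2D (2D ^ D)) ⟩
  2 * F * 2D * 2D ^ D       ≤⟨ *-monoʳ-≤ (2 * F * 2D) ratio ⟩
  2 * F * 2D * (2 * c ^ D)  ≡⟨ regroup F D (c ^ D) ⟩
  8 * D * F * c ^ D         ≤⟨ *-monoˡ-≤ (c ^ D) h ⟩
  2 ^ d * c ^ D             ≡⟨ sym (trans (*-comm (1 * c ^ D) (2 ^ d)) (cong (2 ^ d *_) (*-identityˡ (c ^ D)))) ⟩
  1 * c ^ D * 2 ^ d         ∎
  where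
  open ≤-Reasoning
  D c 2D : ℕ
  D  = suc D'
  c  = D' + suc D'
  2D = D + D
  ratio : 2D ^ D ≤ 2 * c ^ D
  ratio = *-cancelʳ-≤ (2D ^ D) (2 * c ^ D) D
    (subst (2D ^ D * D ≤_) (double (c ^ D) D) (bernoulli c D D refl))
    where double : ∀ x y → x * (y + y) ≡ 2 * x * y
          double = solve-∀
  regroup : ∀ F D y → 2 * F * (D + D) * (2 * y) ≡ 8 * D * F * y
  regroup = solve-∀

-- 4d²(d² + d + 2) ≤ 2^d for d ≥ 20: the quartic grows by a factor below 2
-- per step once d ≥ 8, since (9/8)⁴ < 2.
quartic : ℕ → ℕ
quartic d = 4 * (d * d) * (d * d + d + 2)

quartic-step : ∀ x → 8 ≤ x → quartic (suc x) ≤ 2 * quartic x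
quartic-step x 8≤x = *-cancelˡ-≤ 4096 (begin
  4096 * quartic (suc x)                                   ≡⟨ scale₆₄ (suc x * suc x) (suc x * suc x + suc x + 2) ⟩
  4 * (64 * (suc x * suc x)) * (64 * (suc x * suc x + suc x + 2))
                                                           ≤⟨ *-mono-≤ (*-monoʳ-≤ 4 square) sum ⟩
  4 * (81 * (x * x)) * (81 * (x * x + x + 2))              ≡⟨ scale₈₁ (x * x) (x * x + x + 2) ⟩
  6561 * quartic x                                         ≤⟨ *-monoˡ-≤ (quartic x) (toWitness {a? = 6561 ≤? 8192} tt) ⟩
  8192 * quartic x                                         ≡⟨ *-assoc 4096 2 (quartic x) ⟩
  4096 * (2 * quartic x)                                   ∎)
  where
  open ≤-Reasoning
  scale₆₄ : ∀ A B → 4096 * (4 * A * B) ≡ 4 * (64 * A) * (64 * B)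
  scale₆₄ = solve-∀
  scale₈₁ : ∀ A B → 4 * (81 * A) * (81 * B) ≡ 6561 * (4 * A * B)
  scale₈₁ = solve-∀
  linear : 8 * suc x ≤ 9 * x
  linear = begin
    8 * suc x  ≡⟨ *-suc 8 x ⟩
    8 + 8 * x  ≤⟨ +-monoˡ-≤ (8 * x) 8≤x ⟩
    9 * x      ∎
  square : 64 * (suc x * suc x) ≤ 81 * (x * x)
  square = begin
    64 * (suc x * suc x)       ≡⟨ squares₈ (suc x) ⟩
    (8 * suc x) * (8 * suc x)  ≤⟨ *-mono-≤ linear linear ⟩
    (9 * x) * (9 * x)          ≡⟨ squares₉ x ⟩
    81 * (x * x)               ∎
    where squares₈ : ∀ y → 64 * (y * y) ≡ (8 * y) * (8 * y)
          squares₈ = solve-∀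
          squares₉ : ∀ y → (9 * y) * (9 * y) ≡ 81 * (y * y)
          squares₉ = solve-∀
  linear₆₄ : 64 * suc x ≤ 81 * x
  linear₆₄ = begin
    64 * suc x       ≡⟨ *-assoc 8 8 (suc x) ⟩
    8 * (8 * suc x)  ≤⟨ *-monoʳ-≤ 8 linear ⟩
    8 * (9 * x)      ≡⟨ sym (*-assoc 8 9 x) ⟩
    72 * x           ≤⟨ *-monoˡ-≤ x (toWitness {a? = 72 ≤? 81} tt) ⟩
    81 * x           ∎
  sum : 64 * (suc x * suc x + suc x + 2) ≤ 81 * (x * x + x + 2)
  sum = begin
    64 * (suc x * suc x + suc x + 2)       ≡⟨ spread₆₄ (suc x * suc x) (suc x) ⟩
    64 * (suc x * suc x) + 64 * suc x + 128 ≤⟨ +-mono-≤ (+-mono-≤ square linear₆₄) (toWitness {a? = 128 ≤? 162} tt) ⟩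
    81 * (x * x) + 81 * x + 162            ≡⟨ sym (spread₈₁ (x * x) x) ⟩
    81 * (x * x + x + 2)                   ∎
    where spread₆₄ : ∀ A y → 64 * (A + y + 2) ≡ 64 * A + 64 * y + 128
          spread₆₄ = solve-∀
          spread₈₁ : ∀ A y → 81 * (A + y + 2) ≡ 81 * A + 81 * y + 162
          spread₈₁ = solve-∀

-- The inductive step, for a variable x so that 2 ^ x is never unfolded.
quartic-power-step : ∀ x → 8 ≤ x → quartic x ≤ 2 ^ x → quartic (suc x) ≤ 2 ^ suc x
quartic-power-step x 8≤x ih = ≤-trans (quartic-step x 8≤x) (*-monoʳ-≤ 2 ih)

quartic-below-power : ∀ d → 20 ≤ d → quartic d ≤ 2 ^ d
quartic-below-power d 20≤d = fromBase (proj₁ excess) d (proj₂ excess)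
  where
  excess : ∃ λ e → 20 + e ≡ d
  excess = m≤n⇒∃[o]m+o≡n 20≤d
  fromBase : ∀ e x → 20 + e ≡ x → quartic x ≤ 2 ^ x
  fromBase zero    x eq = subst (λ y → quartic y ≤ 2 ^ y) eq (toWitness {a? = quartic 20 ≤? 2 ^ 20} tt)
  fromBase (suc e) x eq = subst (λ y → quartic y ≤ 2 ^ y) (trans (sym (+-suc 20 e)) eq)
    (quartic-power-step (20 + e) (≤-trans (toWitness {a? = 8 ≤? 20} tt) (m≤m+n 20 e))
      (fromBase e (20 + e) refl))

balanced-large : ∀ {n} (G : Graph n) d → 20 ≤ d → Regular G d → Balanced G 3
balanced-large G (suc x) 20≤d regular =
  BalancedColouring.balanced G d regular 3 1 (D' + suc D') (≤-trans (s≤s z≤n) (m≤n+m (suc D') D'))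
    (condition-large d D' (lowerTail d 3) refl quartic-bound)
  where
  d D' : ℕ
  d  = suc x
  D' = x + x * d
  quartic-bound : 8 * (d * d) * lowerTail d 3 ≤ 2 ^ d
  quartic-bound = subst (_≤ 2 ^ d)
    (trans (cong (λ t → 4 * (d * d) * t) (sym (lowerTail-3 d))) (regroup (d * d) (lowerTail d 3)))
    (quartic-below-power d 20≤d)
    where regroup : ∀ x y → 4 * x * (2 * y) ≡ 8 * x * y
          regroup = solve-∀

balanced-small : ∀ {n} (G : Graph n) d k .{{_ : NonZero d}} → Regular G d →
  True (2 * lowerTail d k * (1 + d * d) ^ suc (d * d) ≤? 1 * (d * d) ^ (d * d) * 2 ^ d) →
  Balanced G k
balanced-small G d k regular checked =
  BalancedColouring.balanced G d regular k 1 (d * d) (>-nonZero⁻¹ (d * d) {{m*n≢0 d d}}) (toWitness checked)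

DegreePartition : ∀ {n} → Graph n → ℕ → Set
DegreePartition {n} G d = Σ (VSet n) λ V0 →
  (∀ v → V0 v ≡ true → 2 + d % 2 ≤ degIn G V0 v)
  × (∀ v → V0 v ≡ true → 2 ≤ degIn G (compl V0) v)
  × (∀ v → V0 v ≡ false → 2 + d % 2 ≤ degIn G (compl V0) v)
  × (∀ v → V0 v ≡ false → 2 ≤ degIn G V0 v)

degreePartition : ∀ {n} (G : Graph n) d k → 2 + d % 2 ≤ k → 2 ≤ k → Balanced G k → DegreePartition G d
degreePartition G d k r≤k 2≤k (V0 , enough) =
  V0 , (λ v _ → ≤-trans r≤k (proj₁ (enough v))) , (λ v _ → ≤-trans 2≤k (proj₂ (enough v)))
     , (λ v _ → ≤-trans r≤k (proj₂ (enough v))) , (λ v _ → ≤-trans 2≤k (proj₁ (enough v)))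

degreePartition-exists : ∀ {n} (G : Graph n) e → Regular G (14 + e) → 14 + e ≢ 15 → 14 + e ≢ 17 →
  DegreePartition G (14 + e)
degreePartition-exists G 0 regular _ _ = degreePartition G 14 2 ≤-refl ≤-refl (balanced-small G 14 2 regular tt)
degreePartition-exists G 1 _ ≢15 _     = ⊥-elim (≢15 refl)
degreePartition-exists G 2 regular _ _ = degreePartition G 16 2 ≤-refl ≤-refl (balanced-small G 16 2 regular tt)
degreePartition-exists G 3 _ _ ≢17     = ⊥-elim (≢17 refl)
degreePartition-exists G 4 regular _ _ = degreePartition G 18 2 ≤-refl ≤-refl (balanced-small G 18 2 regular tt)
degreePartition-exists G 5 regular _ _ = degreePartition G 19 3 ≤-refl (s≤s (s≤s z≤n)) (balanced-small G 19 3 regular tt)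
degreePartition-exists G (suc (suc (suc (suc (suc (suc e)))))) regular _ _ =
  degreePartition G (20 + e) 3 (+-monoʳ-≤ 2 (≤-pred (m%n<n (20 + e) 2))) (s≤s (s≤s z≤n)) (balanced-large G (20 + e) (m≤m+n 20 e) regular)

lemma3 : ∀ {n} (G : Graph n) (d : ℕ) → Regular G d → 14 ≤ d → d ≢ 15 → d ≢ 17 →
    Σ (VSet n) λ V0 →
    (∀ v → V0 v ≡ true → 2 + d % 2 ≤ degIn G V0 v)
    × (∀ v → V0 v ≡ true → 2 ≤ degIn G (compl V0) v)
    × (∀ v → V0 v ≡ false → 2 + d % 2 ≤ degIn G (compl V0) v)
    × (∀ v → V0 v ≡ false → 2 ≤ degIn G V0 v)
lemma3 G d regular 14≤d ≢15 ≢17 = subst (DegreePartition G) 14+e≡d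
  (degreePartition-exists G e (subst (Regular G) (sym 14+e≡d) regular)
    (≢15 ∘ trans (sym 14+e≡d)) (≢17 ∘ trans (sym 14+e≡d)))
  where
  excess : ∃ λ e → 14 + e ≡ d
  excess = m≤n⇒∃[o]m+o≡n 14≤d
  e : ℕ
  e = proj₁ excess
  14+e≡d : 14 + e ≡ d
  14+e≡d = proj₂ excess
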